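{- Let $G$ be a bipartite graph with bipartition classes $A,B$ and let $P\subseteq G$ be a generalised path. Then $P$ is concentrated on $A$ if and only if all limits of $P$ are contained in $B$.
   Context: A generalised path is a graph $P$ with a well-order $\prec$ on $V(P)$ such that for every vertex $v$ and every $v'\prec v$ there is a neighbour $w$ of $v$ in $P$ with $v'\preceq w\prec v$; its limits $\Lambda(P)$ are the limit elements of this well-order. $P$ is concentrated on $A$ if $N_G(v)\cap A\cap\{u: x\preceq u\prec v\}\neq\emptyset$ for all $v\in\Lambda(P)$ and all $x\prec v$. -}

module Defs where

open import Data.Product using (Σ; ∃; _×_; _,_)
open import Data.Sum using (_⊎_)
open import Data.Empty using (⊥)
open import Relation.Nullary using (¬_)
open import Relation.Binary.PropositionalEquality using (_≡_)
open import Relation.Binary.Structures using (IsStrictTotalOrder)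
open import Induction.WellFounded using (WellFounded)
open import Function.Definitions using (Injective)

record Graph : Set₁ where
  field
    V        : Set
    _~_      : V → V → Set
    ~-sym    : ∀ {x y} → x ~ y → y ~ x
    ~-irrefl : ∀ {x} → ¬ (x ~ x)

record Bipartition (G : Graph) (A B : Graph.V G → Set) : Set where
  open Graph G
  field
    cover    : ∀ v → A v ⊎ B v
    disjoint : ∀ v → ¬ (A v × B v)
    edges    : ∀ {x y} → x ~ y → (A x × B y) ⊎ (B x × A y)

record Subgraph (G : Graph) : Set₁ where
  open Graph G
  field
    PV      : Set
    ι       : PV → V
    ι-inj   : Injective _≡_ _≡_ ι
    _~P_    : PV → PV → Set
    ~P-sym  : ∀ {x y} → x ~P y → y ~P x
    ~P⊆~    : ∀ {x y} → x ~P y → ι x ~ ι y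

_⟨_⟩⪯_ : {X : Set} → X → (X → X → Set) → X → Set
x ⟨ _≺_ ⟩⪯ y = (x ≺ y) ⊎ (x ≡ y)

record GenPath (G : Graph) : Set₁ where
  field
    sub   : Subgraph G
  open Subgraph sub public
  field
    _≺_       : PV → PV → Set
    isSTO     : IsStrictTotalOrder _≡_ _≺_
    wf        : WellFounded _≺_
    connected : ∀ v v' → v' ≺ v → Σ PV (λ w → (v ~P w) × (v' ⟨ _≺_ ⟩⪯ w) × (w ≺ v))

  IsLimit : PV → Set
  IsLimit v = ¬ (∀ x → ¬ (x ≺ v))
            × ¬ (Σ PV λ u → (u ≺ v) × (∀ y → ¬ ((u ≺ y) × (y ≺ v))))

Concentrated : (G : Graph) (P : GenPath G) → (Graph.V G → Set) → Set
Concentrated G P A =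
  ∀ v → IsLimit v → ∀ x → x ≺ v →
    Σ PV λ u → (x ⟨ _≺_ ⟩⪯ u) × (u ≺ v) × (Graph._~_ G (ι v) (ι u)) × A (ι u)
  where open GenPath P

LimitsIn : (G : Graph) (P : GenPath G) → (Graph.V G → Set) → Set
LimitsIn G P B = ∀ v → IsLimit v → B (ι v)
  where open GenPath P

-- A limit v has P-neighbours arbitrarily close below it; if v ∈ B they lie in A,
-- so P is concentrated on A. Conversely, a limit is not minimal, so concentration
-- yields a G-neighbour of v in A, whence v ∉ A and so v ∈ B.
module Submission where

open import Defs
open import Function.Bundles using (_⇔_; mk⇔)
open import Data.Product using (_,_)
open import Data.Sum using (inj₁; inj₂)
open import Data.Empty using (⊥-elim)
open import Relation.Nullary using (¬_)

module _ {G : Graph} {A B : Graph.V G → Set} (bp : Bipartition G A B) where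
  open Graph G
  open Bipartition bp

  in-B⇒neighbour-in-A : ∀ {x y} → B x → x ~ y → A y
  in-B⇒neighbour-in-A bx e with edges e
  ... | inj₁ (ax , _) = ⊥-elim (disjoint _ (ax , bx))
  ... | inj₂ (_ , ay) = ay

  neighbour-in-A⇒∉A : ∀ {x y} → x ~ y → A y → ¬ A x
  neighbour-in-A⇒∉A e ay ax with edges e
  ... | inj₁ (_ , by) = disjoint _ (ay , by)
  ... | inj₂ (bx , _) = disjoint _ (ax , bx)

  ∉A⇒in-B : ∀ {x} → ¬ A x → B x
  ∉A⇒in-B {x} x∉A with cover x
  ... | inj₁ ax = ⊥-elim (x∉A ax)
  ... | inj₂ bx = bx

lemma3p2 : (G : Graph) (A B : Graph.V G → Set) → Bipartition G A B →
    (P : GenPath G) → Concentrated G P A ⇔ LimitsIn G P B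
lemma3p2 G A B bp P = mk⇔ concentrated⇒limits-in-B limits-in-B⇒concentrated
  where
  open GenPath P

  concentrated⇒limits-in-B : Concentrated G P A → LimitsIn G P B
  concentrated⇒limits-in-B conc v lim@(not-minimal , _) = ∉A⇒in-B bp v∉A
    where
    v∉A : ¬ A (ι v)
    v∉A av = not-minimal λ x x≺v →
      let (u , _ , _ , v~u , au) = conc v lim x x≺v
      in neighbour-in-A⇒∉A bp v~u au av

  limits-in-B⇒concentrated : LimitsIn G P B → Concentrated G P A
  limits-in-B⇒concentrated inB v lim x x≺v with connected v x x≺v
  ... | w , v~w , x⪯w , w≺v =
    w , x⪯w , w≺v , ~P⊆~ v~w , in-B⇒neighbour-in-A bp (inB v lim) (~P⊆~ v~w)
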